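{- Let $X$ be a finite set with $|X|=n\ge 1$ and let $\mathcal{F}\subseteq 2^X$ be a union-closed family of subsets of $X$ with $\bigcup_{f\in\mathcal{F}}f=X$. Then $$|J(\mathcal{F})|\le 2\binom{n}{\lfloor n/2\rfloor}+\binom{n}{\lfloor n/2\rfloor+1}.$$ In particular, any family $S\subseteq 2^X$ with $|S|>2\binom{n}{\lfloor n/2\rfloor}+\binom{n}{\lfloor n/2\rfloor+1}$ is not $\cup$-independent.
   Context: A family $\mathcal{F}\subseteq 2^X$ is union-closed if $f,g\in\mathcal{F}$ implies $f\cup g\in\mathcal{F}$. An element $g\in\mathcal{F}$ is (join-)irreducible if whenever $g=h\cup t$ with $h,t\in\mathcal{F}$ then $h=g$ or $t=g$; $J(\mathcal{F})$ denotes the set of irreducible elements of $\mathcal{F}$. A family $S\subseteq 2^X$ is $\cup$-independent if no element $z\in S$ can be written as a union of elements of $S\setminus\{z\}$. -}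

module Defs where

open import Data.Nat using (ℕ; suc; _+_; _*_; _/_)
open import Data.Nat.Combinatorics using (_C_)
open import Data.Fin using (Fin)
open import Data.Fin.Subset using (Subset; _∪_; ⊥)
open import Data.List using (List; []; _∷_; foldr)
open import Data.List.Membership.Propositional using () renaming (_∈_ to _∈ᴸ_)
open import Data.List.Relation.Unary.All using (All)
open import Data.Product using (Σ; ∃; _×_)
open import Data.Sum using (_⊎_)
open import Relation.Binary.PropositionalEquality using (_≡_; _≢_)
open import Relation.Nullary using (¬_)

-- The ground set X is Fin n; a subset of X is a `Subset n`.
-- A family of subsets of X is given by a list of subsets (read as the set
-- of its entries; membership is list membership).
Family : ℕ → Set
Family n = List (Subset n)

UnionClosed : ∀ {n} → Family n → Set
UnionClosed F = ∀ {f g} → f ∈ᴸ F → g ∈ᴸ F → (f ∪ g) ∈ᴸ F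

Covers : ∀ {n} → Family n → Set
Covers {n} F = (x : Fin n) → ∃ λ f → f ∈ᴸ F × Data.Fin.Subset._∈_ x f

Irreducible : ∀ {n} → Family n → Subset n → Set
Irreducible F g =
  g ∈ᴸ F × (∀ {h t} → h ∈ᴸ F → t ∈ᴸ F → g ≡ h ∪ t → (h ≡ g) ⊎ (t ≡ g))

⋃ : ∀ {n} → List (Subset n) → Subset n
⋃ = foldr _∪_ ⊥

UnionOfOthers : ∀ {n} → Family n → Subset n → Set
UnionOfOthers S z =
  Σ (List _) λ T → (T ≢ []) × All (λ s → s ∈ᴸ S × s ≢ z) T × z ≡ ⋃ T

UnionIndependent : ∀ {n} → Family n → Set
UnionIndependent S = ∀ {z} → z ∈ᴸ S → ¬ UnionOfOthers S z

bound : ℕ → ℕ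
bound n = 2 * (n C (n / 2)) + n C suc (n / 2)

module Submission where

open import Defs
open import Data.Nat using (ℕ; _≤_; _<_)
open import Data.List using (List; length)
open import Data.List.Relation.Unary.All using (All)
open import Data.List.Relation.Unary.Unique.Propositional using (Unique)
open import Data.Fin.Subset using (Subset)
open import Data.Product using (_×_)
open import Relation.Nullary using (¬_)

open import Data.Bool using (if_then_else_)
import Data.Bool.Properties as Bool
open import Data.Empty using (⊥-elim) renaming (⊥ to ⊥′)
open import Data.Fin using (Fin; zero; suc; toℕ; fromℕ<)
open import Data.Fin.Properties using (all?; toℕ-fromℕ<)
open import Data.Fin.Subset
  using (_∈_; _∉_; _⊆_; _⊂_; _─_; _-_; ⁅_⁆; ∣_∣; ⊤; ⊥; inside; outside)
open import Data.Fin.Subset.Properties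
  using (_∈?_; _⊂?_; drop-∷-⊆; ⊆-antisym; ⊆⊤; ⊂-irref; p⊆q⇒∣p∣≤∣q∣; p⊂q⇒∣p∣<∣q∣; ∣p∣≤n;
         ∣⊤∣≡n; ∣⊥∣≡0; ∣⁅x⁆∣≡1; x∈⁅x⁆; x∈⁅y⁆⇒x≡y; ∉⊥; nonempty?; Empty-unique; p─q⊆p;
         x∈p∧x∉q⇒x∈p─q; x∈p∧x≢y⇒x∈p-y; x∈p∪q⁻; p⊆p∪q; q⊆p∪q; ∪-identityʳ)
open import Data.List using ([]; _∷_; filter)
open import Data.List.Properties using (filter-all)
open import Data.List.Membership.Propositional using () renaming (_∈_ to _∈ᴸ_)
open import Data.List.Membership.Propositional.Properties using (∈-filter⁻; ∈-filter⁺)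
open import Data.List.Membership.DecPropositional using () renaming (_∈?_ to ∈ᴸ-dec)
open import Data.List.Relation.Unary.All as All using (_∷_)
open import Data.List.Relation.Unary.Any as Any using ()
open import Data.List.Relation.Unary.AllPairs using (_∷_)
open import Data.List.Relation.Unary.Unique.Propositional.Properties using (filter⁺)
open import Data.Nat
  using (zero; suc; _+_; _*_; _∸_; _^_; _!; _≤′_; _≤?_; _<?_; z≤n; s≤s; ≤′-refl; ≤′-step;
         NonZero; >-nonZero; ≢-nonZero⁻¹; ⌊_/2⌋; ⌈_/2⌉)
open import Data.Nat.Properties
open import Algebra.Properties.CommutativeMonoid.Sum +-0-commutativeMonoid
  using (sum; sum-syntax; ∑-distrib-+; sum-replicate-zero; sum-cong-≗)
open import Algebra.Properties.CommutativeSemigroup +-commutativeSemigroup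
  using () renaming (x∙yz≈y∙xz to x+[y+z]≡y+[x+z])
open import Algebra.Properties.CommutativeSemigroup *-commutativeSemigroup
  using () renaming (x∙yz≈y∙xz to x*[y*z]≡y*[x*z])
open import Data.Nat.Combinatorics
  using (_C_; nCk≡n!/k![n-k]!; k![n∸k]!∣n!; nCk≡nC[n∸k]; [n-k]*d[k+1]≡[k+1]*d[k]; [n-k]*[n-k-1]!≡[n-k]!)
open import Data.Nat.DivMod
  using (_/_; _%_; m/n*n≡m; m/n*n≤m; m≡m%n+[m/n]*n; m%n<n; /-monoˡ-≤; m/n≡1+[m∸n]/n)
open import Data.Nat.Tactic.RingSolver using (solve-∀)
open import Data.Product using (∃; _,_; proj₁; proj₂)
open import Data.Sum using (inj₁; inj₂; [_,_]′)
open import Data.Unit using (tt)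
open import Data.Vec using ([]; _∷_; here; there)
open import Data.Vec.Properties using (≡-dec)
open import Function using (_∘_; _∘′_; id)
open import Relation.Binary.Definitions using (Reflexive; Transitive)
open import Relation.Binary.PropositionalEquality
open import Relation.Nullary using (Dec; yes; no; does; ¬?; contradiction)
open import Relation.Nullary.Decidable using (toWitness)

-- Let S be a duplicate-free family of subsets of an n-set X in which every nonempty
-- member g has a *private point*: some x ∈ g lying in no member of S properly contained
-- in g.  Irreducible elements of a union-closed family and ∪-independent families both
-- have this property, so both parts of the theorem follow from the bound
-- |S| ≤ 2·C(n,⌊n/2⌋) + C(n,⌊n/2⌋+1) for such S  (private-points-bound).
--
-- The bound comes from a weighted LYM inequality (module WeightedLYM): if all members of
-- a family G with private points have size ≥ a, then  Σ_{g∈G} a/(|g|·C(n,|g|)) ≤ 1.  It is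
-- proved by induction on the size of the ground set, splitting off the ground set itself
-- (via its private point) or distributing the weight of each member over the points it
-- misses.  Applying it with a = ⌈n/4⌉ to the members of size ≥ a, and with a = 1 to the
-- members of size 1 … ⌈n/4⌉-1, and using the unimodality of k ↦ (k-1)!(n-k)!, bounds the two
-- bands by 2·C(n,⌊n/2⌋) and j·C(n,j) (j = ⌈n/4⌉-1); the empty set contributes at most 1.
-- Finally j·C(n,j) + 1 ≤ C(n,⌊n/2⌋+1) (Decay), by a growth estimate on binomial
-- coefficients for j ≥ 12 and by evaluation for n ≤ 48.

when : {P : Set} → Dec P → ℕ → ℕ
when d c = if does d then c else 0

when-yes : {P : Set} (d : Dec P) → P → ∀ c → when d c ≡ c
when-yes (yes _) _ c = refl
when-yes (no ¬p) p c = contradiction p ¬p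

when-no : {P : Set} (d : Dec P) → ¬ P → ∀ c → when d c ≡ 0
when-no (yes p) ¬p c = contradiction p ¬p
when-no (no _)  _  c = refl

sumᴸ : {A : Set} → List A → (A → ℕ) → ℕ
sumᴸ []       f = 0
sumᴸ (x ∷ xs) f = f x + sumᴸ xs f

module _ {A : Set} where

  sumᴸ-cong : (xs : List A) {f g : A → ℕ} → (∀ {x} → x ∈ᴸ xs → f x ≡ g x) → sumᴸ xs f ≡ sumᴸ xs g
  sumᴸ-cong []       eq = refl
  sumᴸ-cong (x ∷ xs) eq = cong₂ _+_ (eq (Any.here refl)) (sumᴸ-cong xs (eq ∘′ Any.there))

  length*≤sumᴸ : (xs : List A) {f : A → ℕ} {c : ℕ} → (∀ {x} → x ∈ᴸ xs → c ≤ f x) →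
                 length xs * c ≤ sumᴸ xs f
  length*≤sumᴸ []       lb = z≤n
  length*≤sumᴸ (x ∷ xs) lb = +-mono-≤ (lb (Any.here refl)) (length*≤sumᴸ xs (λ m → lb (Any.there m)))

  sumᴸ-filter : {P : A → Set} (P? : ∀ x → Dec (P x)) (xs : List A) (f : A → ℕ) →
                sumᴸ (filter P? xs) f ≡ sumᴸ xs (λ x → when (P? x) (f x))
  sumᴸ-filter P? []       f = refl
  sumᴸ-filter P? (x ∷ xs) f with P? x
  ... | yes _ = cong (f x +_) (sumᴸ-filter P? xs f)
  ... | no  _ = sumᴸ-filter P? xs f

  sumᴸ-when : {P : Set} (d : Dec P) (xs : List A) (f : A → ℕ) →
              sumᴸ xs (λ x → when d (f x)) ≡ when d (sumᴸ xs f)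
  sumᴸ-when (yes _) xs f = refl
  sumᴸ-when (no _)  []       f = refl
  sumᴸ-when (no ¬p) (x ∷ xs) f = sumᴸ-when (no ¬p) xs f

  sumᴸ-∑-comm : ∀ {n} (xs : List A) (f : A → Fin n → ℕ) →
                sumᴸ xs (λ x → ∑[ y < n ] f x y) ≡ ∑[ y < n ] sumᴸ xs (λ x → f x y)
  sumᴸ-∑-comm {n} []       f = sym (sum-replicate-zero n)
  sumᴸ-∑-comm     (x ∷ xs) f = trans (cong (sum (f x) +_) (sumᴸ-∑-comm xs f))
                                     (sym (∑-distrib-+ (f x) (λ y → sumᴸ xs (λ z → f z y))))

  sumᴸ-remove : (_≟_ : (x y : A) → Dec (x ≡ y)) {xs : List A} {y : A} → Unique xs → y ∈ᴸ xs →
                (f : A → ℕ) → sumᴸ xs f ≡ f y + sumᴸ (filter (λ x → ¬? (x ≟ y)) xs) f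
  sumᴸ-remove _≟_ {x ∷ xs} (x∉xs ∷ _) (Any.here refl) f with x ≟ x
  ... | no x≢x = contradiction refl x≢x
  ... | yes _  = cong (λ ys → f x + sumᴸ ys f) (sym (filter-all (λ z → ¬? (z ≟ x)) xs≢x))
    where xs≢x = All.map (λ x≢z z≡x → x≢z (sym z≡x)) x∉xs
  sumᴸ-remove _≟_ {x ∷ xs} {y} (x∉xs ∷ u) (Any.there y∈xs) f with x ≟ y
  ... | yes refl = contradiction refl (All.lookup x∉xs y∈xs)
  ... | no _     = begin
    f x + sumᴸ xs f                    ≡⟨ cong (f x +_) (sumᴸ-remove _≟_ u y∈xs f) ⟩
    f x + (f y + sumᴸ rest f)          ≡⟨ x+[y+z]≡y+[x+z] (f x) (f y) _ ⟩
    f y + (f x + sumᴸ rest f)          ∎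
    where open ≡-Reasoning
          rest = filter (λ z → ¬? (z ≟ y)) xs

∑-mono-≤ : ∀ {n} {f g : Fin n → ℕ} → (∀ y → f y ≤ g y) → ∑[ y < n ] f y ≤ ∑[ y < n ] g y
∑-mono-≤ {zero}  le = z≤n
∑-mono-≤ {suc n} le = +-mono-≤ (le zero) (∑-mono-≤ (λ y → le (suc y)))

∑-when-∈ : ∀ {n} (p : Subset n) c → ∑[ y < n ] when (y ∈? p) c ≡ ∣ p ∣ * c
∑-when-∈ []            c = refl
∑-when-∈ (inside  ∷ p) c = cong (c +_) (∑-when-∈ p c)
∑-when-∈ (outside ∷ p) c = ∑-when-∈ p c

length-filter-split : ∀ {A : Set} {P : A → Set} (P? : ∀ x → Dec (P x)) (xs : List A) →
                      length xs ≡ length (filter P? xs) + length (filter (λ x → ¬? (P? x)) xs)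
length-filter-split P? []       = refl
length-filter-split P? (x ∷ xs) with P? x
... | yes _ = cong suc (length-filter-split P? xs)
... | no  _ = trans (cong suc (length-filter-split P? xs)) (sym (+-suc _ _))

unique-constant : ∀ {A : Set} {c : A} (xs : List A) → Unique xs → (∀ {x} → x ∈ᴸ xs → x ≡ c) → length xs ≤ 1
unique-constant []           _ _ = z≤n
unique-constant (x ∷ [])     _ _ = s≤s z≤n
unique-constant (x ∷ y ∷ xs) (x∉ ∷ _) ≡c =
  contradiction (trans (≡c (Any.here refl)) (sym (≡c (Any.there (Any.here refl))))) (All.head x∉)

length-absurd : ∀ {A : Set} (xs : List A) → (∀ {x} → x ∈ᴸ xs → ⊥′) → length xs ≡ 0
length-absurd []       _      = refl
length-absurd (x ∷ xs) absurd = ⊥-elim (absurd (Any.here refl))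

_≟ˢ_ : ∀ {n} (p q : Subset n) → Dec (p ≡ q)
_≟ˢ_ = ≡-dec Bool._≟_

∈─⇒∉ : ∀ {n} {p q : Subset n} {x} → x ∈ p ─ q → x ∉ q
∈─⇒∉ {p = inside ∷ p} {q = outside ∷ q} here        ()
∈─⇒∉ {p = s      ∷ p} {q = t       ∷ q} (there x∈) (there x∈q) = ∈─⇒∉ x∈ x∈q

∣─∣+∣∣≡∣∣ : ∀ {n} {p q : Subset n} → q ⊆ p → ∣ p ─ q ∣ + ∣ q ∣ ≡ ∣ p ∣
∣─∣+∣∣≡∣∣ {p = []} {q = []}          q⊆p = refl
∣─∣+∣∣≡∣∣ {p = inside  ∷ p} {q = inside  ∷ q} q⊆p = trans (+-suc _ _) (cong suc (∣─∣+∣∣≡∣∣ (drop-∷-⊆ q⊆p)))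
∣─∣+∣∣≡∣∣ {p = inside  ∷ p} {q = outside ∷ q} q⊆p = cong suc (∣─∣+∣∣≡∣∣ (drop-∷-⊆ q⊆p))
∣─∣+∣∣≡∣∣ {p = outside ∷ p} {q = inside  ∷ q} q⊆p = contradiction (q⊆p here) λ ()
∣─∣+∣∣≡∣∣ {p = outside ∷ p} {q = outside ∷ q} q⊆p = ∣─∣+∣∣≡∣∣ (drop-∷-⊆ q⊆p)

module _ {n : ℕ} where

  ⊆∧≢⇒⊂ : {p q : Subset n} → p ⊆ q → p ≢ q → p ⊂ q
  ⊆∧≢⇒⊂ {p} {q} p⊆q p≢q with p ⊂? q
  ... | yes p⊂q = p⊂q
  ... | no  p⊄q = contradiction (⊆-antisym p⊆q q⊆p) p≢q
    where
      q⊆p : q ⊆ p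
      q⊆p {x} x∈q with x ∈? p
      ... | yes x∈p = x∈p
      ... | no  x∉p = contradiction ((λ {y} → p⊆q {y}) , x , x∈q , x∉p) p⊄q

  ⁅⁆⊆ : {p : Subset n} {x : Fin n} → x ∈ p → ⁅ x ⁆ ⊆ p
  ⁅⁆⊆ {p} {x} x∈p y∈⁅x⁆ = subst (_∈ p) (sym (x∈⁅y⁆⇒x≡y x y∈⁅x⁆)) x∈p

  ∈⇒1≤∣∣ : {p : Subset n} {x : Fin n} → x ∈ p → 1 ≤ ∣ p ∣
  ∈⇒1≤∣∣ {p} {x} x∈p = subst (_≤ ∣ p ∣) (∣⁅x⁆∣≡1 x) (p⊆q⇒∣p∣≤∣q∣ (⁅⁆⊆ x∈p))

  ∣-∣ : {p : Subset n} {x : Fin n} → x ∈ p → suc ∣ p - x ∣ ≡ ∣ p ∣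
  ∣-∣ {p} {x} x∈p = begin
    suc ∣ p - x ∣          ≡⟨ +-comm 1 ∣ p - x ∣ ⟩
    ∣ p - x ∣ + 1          ≡⟨ cong (∣ p - x ∣ +_) (∣⁅x⁆∣≡1 x) ⟨
    ∣ p - x ∣ + ∣ ⁅ x ⁆ ∣  ≡⟨ ∣─∣+∣∣≡∣∣ (⁅⁆⊆ x∈p) ⟩
    ∣ p ∣                  ∎
    where open ≡-Reasoning

  ⊆-minus : {p q : Subset n} {y : Fin n} → p ⊆ q → y ∉ p → p ⊆ q - y
  ⊆-minus {p} p⊆q y∉p x∈p = x∈p∧x≢y⇒x∈p-y (p⊆q x∈p) (λ x≡y → y∉p (subst (_∈ p) x≡y x∈p))

  when-─ : (y : Fin n) (p q : Subset n) (c : ℕ) →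
           when (y ∈? p ─ q) c ≡ when (y ∈? p) (when (¬? (y ∈? q)) c)
  when-─ y p q c with y ∈? p
  ... | no  y∉p = when-no (y ∈? p ─ q) (λ y∈p─q → y∉p (p─q⊆p p q y∈p─q)) c
  ... | yes y∈p with y ∈? q
  ...   | yes y∈q = when-no (y ∈? p ─ q) (λ y∈p─q → ∈─⇒∉ y∈p─q y∈q) c
  ...   | no  y∉q = when-yes (y ∈? p ─ q) (x∈p∧x∉q⇒x∈p─q y∈p y∉q) c

≢⊥⇒1≤∣∣ : ∀ {n} {g : Subset n} → g ≢ ⊥ → 1 ≤ ∣ g ∣
≢⊥⇒1≤∣∣ {g = g} g≢⊥ with nonempty? g
... | yes (_ , x∈g) = ∈⇒1≤∣∣ x∈g
... | no  empty     = contradiction (Empty-unique empty) g≢⊥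

⋃-least : ∀ {n} {T : List (Subset n)} {g} → (∀ {h} → h ∈ᴸ T → h ⊆ g) → ⋃ T ⊆ g
⋃-least {T = []}    _   x∈⊥ = contradiction x∈⊥ ∉⊥
⋃-least {T = h ∷ T} sub x∈  with x∈p∪q⁻ h (⋃ T) x∈
... | inj₁ x∈h  = sub (Any.here refl) x∈h
... | inj₂ x∈⋃T = ⋃-least (sub ∘ Any.there) x∈⋃T

⊆-⋃ : ∀ {n} {T : List (Subset n)} {h} → h ∈ᴸ T → h ⊆ ⋃ T
⊆-⋃ {T = h ∷ T}  (Any.here refl) = p⊆p∪q (⋃ T)
⊆-⋃ {T = h′ ∷ T} (Any.there h∈T) = q⊆p∪q h′ (⋃ T) ∘ ⊆-⋃ h∈T

-- D N k = (k-1)!·(N-k)!, so that  N! = k·C(N,k)·D N k : the reciprocal of D N k / N! is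
-- the number  k·C(N,k)  of pairs (k-set, marked point of it).
D : ℕ → ℕ → ℕ
D N k = (k ∸ 1) ! * (N ∸ k) !

D-suc : ∀ {N k} → k ≤ N → D (suc N) k ≡ (suc N ∸ k) * D N k
D-suc {N} {k} k≤N = begin
  (k ∸ 1) ! * (suc N ∸ k) !                  ≡⟨ cong (λ r → (k ∸ 1) ! * r !) [1+N]∸k ⟩
  (k ∸ 1) ! * (suc (N ∸ k) * (N ∸ k) !)      ≡⟨ x*[y*z]≡y*[x*z] ((k ∸ 1) !) (suc (N ∸ k)) ((N ∸ k) !) ⟩
  suc (N ∸ k) * D N k                        ≡⟨ cong (_* D N k) [1+N]∸k ⟨
  (suc N ∸ k) * D N k                        ∎
  where open ≡-Reasoning
        [1+N]∸k = +-∸-assoc 1 k≤N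

-- The two identities closing the induction of the weighted LYM inequality.
D-top-identity : ∀ {a N} → a ≤ suc N → a * D (suc N) (suc N) + (suc N ∸ a) * N ! ≡ suc N !
D-top-identity {a} {N} a≤1+N = begin
  a * (N ! * (N ∸ N) !) + (suc N ∸ a) * N !  ≡⟨ cong (λ z → a * (N ! * z !) + (suc N ∸ a) * N !) (n∸n≡0 N) ⟩
  a * (N ! * 1) + (suc N ∸ a) * N !          ≡⟨ cong (λ z → a * z + (suc N ∸ a) * N !) (*-identityʳ (N !)) ⟩
  a * N ! + (suc N ∸ a) * N !                ≡⟨ *-distribʳ-+ (N !) a (suc N ∸ a) ⟨
  (a + (suc N ∸ a)) * N !                    ≡⟨ cong (_* N !) (m+[n∸m]≡n a≤1+N) ⟩
  suc N * N !                                ∎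
  where open ≡-Reasoning

D-avoiding-identity : ∀ {a N} → a ≤ N → N * ((N ∸ a) * (N ∸ 1) !) + N ! ≡ (suc N ∸ a) * N !
D-avoiding-identity {N = zero}  z≤n = refl
D-avoiding-identity {a} {suc N} a≤1+N = begin
  suc N * ((suc N ∸ a) * N !) + suc N !    ≡⟨ cong (_+ suc N !) (x*[y*z]≡y*[x*z] (suc N) (suc N ∸ a) (N !)) ⟩
  (suc N ∸ a) * suc N ! + suc N !          ≡⟨ +-comm ((suc N ∸ a) * suc N !) (suc N !) ⟩
  suc (suc N ∸ a) * suc N !                ≡⟨ cong (_* suc N !) (+-∸-assoc 1 a≤1+N) ⟨
  (suc (suc N) ∸ a) * suc N !              ∎
  where open ≡-Reasoning

C-factorial : ∀ {n k} → k ≤ n → (n C k) * (k ! * (n ∸ k) !) ≡ n !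
C-factorial {n} {k} k≤n =
  trans (cong (_* (k ! * (n ∸ k) !)) (nCk≡n!/k![n-k]! k≤n))
        (m/n*n≡m {{k !* (n ∸ k) !≢0}} (k![n∸k]!∣n! k≤n))

C-positive : ∀ {n k} → k ≤ n → 1 ≤ n C k
C-positive {n} {k} k≤n with n C k | C-factorial k≤n
... | zero  | 0≡n! = contradiction (sym 0≡n!) (≢-nonZero⁻¹ (n !) {{n !≢0}})
... | suc _ | _    = s≤s z≤n

C-D-factorial : ∀ {n k} → 1 ≤ k → k ≤ n → k * (n C k) * D n k ≡ n !
C-D-factorial {n} {suc k} _ k≤n = trans (e (suc k) (n C suc k) (k !) ((n ∸ suc k) !)) (C-factorial k≤n)
  where e : ∀ s c f g → s * c * (f * g) ≡ c * (s * f * g)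
        e = solve-∀

C-ratio : ∀ {n k} → k < n → suc k * (n C suc k) ≡ (n ∸ k) * (n C k)
C-ratio {n} {k} k<n = *-cancelʳ-≡ _ _ d[k] {{k !* (n ∸ k) !≢0}} (begin
  suc k * (n C suc k) * d[k]          ≡⟨ e₁ (suc k) (n C suc k) d[k] ⟩
  (n C suc k) * (suc k * d[k])        ≡⟨ cong ((n C suc k) *_) ([n-k]*d[k+1]≡[k+1]*d[k] k<n) ⟨
  (n C suc k) * ((n ∸ k) * d[k+1])    ≡⟨ x*[y*z]≡y*[x*z] (n C suc k) (n ∸ k) d[k+1] ⟩
  (n ∸ k) * ((n C suc k) * d[k+1])    ≡⟨ cong ((n ∸ k) *_) (trans (C-factorial k<n) (sym (C-factorial (<⇒≤ k<n)))) ⟩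
  (n ∸ k) * ((n C k) * d[k])          ≡⟨ *-assoc (n ∸ k) (n C k) d[k] ⟨
  (n ∸ k) * (n C k) * d[k]            ∎)
  where open ≡-Reasoning
        d[k]   = k ! * (n ∸ k) !
        d[k+1] = suc k ! * (n ∸ suc k) !
        e₁ : ∀ s c d → s * c * d ≡ c * (s * d)
        e₁ = solve-∀

C-step : ∀ {n k} c .{{_ : NonZero c}} → c * suc k + k ≤ n → c * (n C k) ≤ n C suc k
C-step {n} {k} c bound = *-cancelˡ-≤ (suc k) (begin
  suc k * (c * (n C k))      ≡⟨ x*[y*z]≡y*[x*z] (suc k) c (n C k) ⟩
  c * (suc k * (n C k))      ≡⟨ *-assoc c (suc k) (n C k) ⟨
  c * suc k * (n C k)        ≤⟨ *-monoˡ-≤ (n C k) (m+n≤o⇒m≤o∸n (c * suc k) bound) ⟩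
  (n ∸ k) * (n C k)          ≡⟨ C-ratio k<n ⟨
  suc k * (n C suc k)        ∎)
  where open ≤-Reasoning
        k<n = ≤-trans (≤-trans (m≤n*m (suc k) c) (m≤m+n (c * suc k) k)) bound

module _ {R : ℕ → ℕ → Set} (R-refl : Reflexive R) (R-trans : Transitive R) where

  chain : (f : ℕ → ℕ) {k l : ℕ} → k ≤ l →
          (∀ {i} → k ≤ i → i < l → R (f i) (f (suc i))) → R (f k) (f l)
  chain f k≤l step = go (≤⇒≤′ k≤l) step
    where
      go : ∀ {l} → _ ≤′ l → (∀ {i} → _ ≤ i → i < l → R (f i) (f (suc i))) → R (f _) (f l)
      go ≤′-refl           _    = R-refl
      go (≤′-step k≤′l) step = R-trans (go k≤′l (λ k≤i i<l → step k≤i (m≤n⇒m≤1+n i<l)))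
                                       (step (≤′⇒≤ k≤′l) ≤-refl)

-- C(n, k+d) ≥ 2^d·C(n,k) while the ratio (n-i)/(i+1) stays ≥ 2
C-doubling : ∀ {n k} d → 3 * (k + d) ≤ suc n → 2 ^ d * (n C k) ≤ n C (k + d)
C-doubling {n} {k} zero    _     = ≤-reflexive (trans (*-identityˡ (n C k)) (cong (n C_) (sym (+-identityʳ k))))
C-doubling {n} {k} (suc d) bound = begin
  2 * 2 ^ d * (n C k)       ≡⟨ *-assoc 2 (2 ^ d) (n C k) ⟩
  2 * (2 ^ d * (n C k))     ≤⟨ *-monoʳ-≤ 2 (C-doubling {n} {k} d 3[k+d]≤1+n) ⟩
  2 * (n C (k + d))         ≤⟨ C-step {n} {k + d} 2 (≤-pred (≤-trans (≤-reflexive (e k d)) bound)) ⟩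
  n C suc (k + d)           ≡⟨ cong (n C_) (+-suc k d) ⟨
  n C (k + suc d)           ∎
  where open ≤-Reasoning
        3[k+d]≤1+n = ≤-trans (*-monoʳ-≤ 3 (+-monoʳ-≤ k (n≤1+n d))) bound
        e : ∀ k d → suc (2 * suc (k + d) + (k + d)) ≡ 3 * (k + suc d)
        e = solve-∀

C-increasing : ∀ {n k l} → k ≤ l → 2 * l ≤ suc n → n C k ≤ n C l
C-increasing {n} k≤l 2l≤1+n = chain {R = _≤_} ≤-refl ≤-trans (n C_) k≤l step
  where
    e : ∀ i → suc (1 * suc i + i) ≡ 2 * suc i
    e = solve-∀
    step : ∀ {i} → _ ≤ i → i < _ → n C i ≤ n C suc i
    step {i} _ i<l = ≤-trans (≤-reflexive (sym (*-identityˡ (n C i))))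
      (C-step {n} {i} 1 (≤-pred (≤-trans (≤-reflexive (e i)) (≤-trans (*-monoʳ-≤ 2 i<l) 2l≤1+n))))

D-step : ∀ {n k} → 1 ≤ k → k < n → D n (suc k) * (n ∸ k) ≡ D n k * k
D-step {n} {suc k} _ k<n = begin
  suc k ! * (n ∸ suc (suc k)) ! * (n ∸ suc k)      ≡⟨ e₁ (suc k !) ((n ∸ suc (suc k)) !) (n ∸ suc k) ⟩
  suc k ! * ((n ∸ suc k) * (n ∸ suc (suc k)) !)    ≡⟨ cong (suc k ! *_) ([n-k]*[n-k-1]!≡[n-k]! k<n) ⟩
  suc k * k ! * (n ∸ suc k) !                      ≡⟨ e₂ (suc k) (k !) ((n ∸ suc k) !) ⟩
  k ! * (n ∸ suc k) ! * suc k                      ∎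
  where open ≡-Reasoning
        e₁ : ∀ a b c → a * b * c ≡ a * (c * b)
        e₁ = solve-∀
        e₂ : ∀ s a b → s * a * b ≡ a * b * s
        e₂ = solve-∀

D-antitone : ∀ {n k l} → 1 ≤ k → k ≤ l → 2 * l ≤ suc n → D n l ≤ D n k
D-antitone {n} {k} 1≤k k≤l 2l≤1+n = chain {R = λ x y → y ≤ x} ≤-refl (λ x y → ≤-trans y x) (D n) k≤l step
  where
    e : ∀ i → suc (suc (i + i)) ≡ 2 * suc i
    e = solve-∀
    step : ∀ {i} → k ≤ i → i < _ → D n (suc i) ≤ D n i
    step {i} k≤i i<l = *-cancelʳ-≤ (D n (suc i)) (D n i) (n ∸ i) {{>-nonZero (m<n⇒0<n∸m i<n)}} (begin
      D n (suc i) * (n ∸ i)   ≡⟨ D-step 1≤i i<n ⟩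
      D n i * i               ≤⟨ *-monoʳ-≤ (D n i) (m+n≤o⇒m≤o∸n i 2i≤n) ⟩
      D n i * (n ∸ i)         ∎)
      where
        open ≤-Reasoning
        1≤i = ≤-trans 1≤k k≤i
        2i+1≤n : suc (i + i) ≤ n
        2i+1≤n = ≤-pred (≤-trans (≤-reflexive (e i)) (≤-trans (*-monoʳ-≤ 2 i<l) 2l≤1+n))
        2i≤n = ≤-trans (n≤1+n _) 2i+1≤n
        i<n = ≤-trans (s≤s (m≤m+n i i)) 2i+1≤n

D-monotone : ∀ {n k l} → k ≤ l → l ≤ n → n ≤ 2 * k → D n k ≤ D n l
D-monotone {n} {k} k≤l l≤n n≤2k = chain {R = _≤_} ≤-refl ≤-trans (D n) k≤l step
  where
    step : ∀ {i} → k ≤ i → i < _ → D n i ≤ D n (suc i)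
    step {i} k≤i i<l = *-cancelʳ-≤ (D n i) (D n (suc i)) (n ∸ i) {{>-nonZero (m<n⇒0<n∸m i<n)}} (begin
      D n i * (n ∸ i)         ≤⟨ *-monoʳ-≤ (D n i) n∸i≤i ⟩
      D n i * i               ≡⟨ D-step 1≤i i<n ⟨
      D n (suc i) * (n ∸ i)   ∎)
      where
        open ≤-Reasoning
        i<n = ≤-trans i<l l≤n
        n≤i+i : n ≤ i + i
        n≤i+i = ≤-trans n≤2k (≤-trans (*-monoʳ-≤ 2 k≤i) (≤-reflexive (cong (i +_) (+-identityʳ i))))
        n∸i≤i = m≤n+o⇒m∸n≤o n i n≤i+i
        1≤i : 1 ≤ i
        1≤i = +-cancelʳ-≤ i 1 i (≤-trans i<n n≤i+i)

⌈n/2⌉≤1+⌊n/2⌋ : ∀ n → ⌈ n /2⌉ ≤ suc ⌊ n /2⌋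
⌈n/2⌉≤1+⌊n/2⌋ zero          = z≤n
⌈n/2⌉≤1+⌊n/2⌋ (suc zero)    = ≤-refl
⌈n/2⌉≤1+⌊n/2⌋ (suc (suc n)) = s≤s (⌈n/2⌉≤1+⌊n/2⌋ n)

2x≡x+x : ∀ x → 2 * x ≡ x + x
2x≡x+x = solve-∀

n≤2⌈n/2⌉ : ∀ n → n ≤ 2 * ⌈ n /2⌉
n≤2⌈n/2⌉ n = begin
  n                      ≡⟨ ⌊n/2⌋+⌈n/2⌉≡n n ⟨
  ⌊ n /2⌋ + ⌈ n /2⌉      ≤⟨ +-monoˡ-≤ ⌈ n /2⌉ (⌊n/2⌋≤⌈n/2⌉ n) ⟩
  ⌈ n /2⌉ + ⌈ n /2⌉      ≡⟨ 2x≡x+x ⌈ n /2⌉ ⟨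
  2 * ⌈ n /2⌉            ∎
  where open ≤-Reasoning

2⌈n/2⌉≤1+n : ∀ n → 2 * ⌈ n /2⌉ ≤ suc n
2⌈n/2⌉≤1+n n = begin
  2 * ⌈ n /2⌉            ≡⟨ 2x≡x+x ⌈ n /2⌉ ⟩
  ⌈ n /2⌉ + ⌈ n /2⌉      ≤⟨ +-monoˡ-≤ ⌈ n /2⌉ (⌈n/2⌉≤1+⌊n/2⌋ n) ⟩
  suc (⌊ n /2⌋ + ⌈ n /2⌉) ≡⟨ cong suc (⌊n/2⌋+⌈n/2⌉≡n n) ⟩
  suc n                  ∎
  where open ≤-Reasoning

-- the bound is stated with n / 2, the library's halving lemmas use ⌊ n /2⌋
n/2≡⌊n/2⌋ : ∀ n → n / 2 ≡ ⌊ n /2⌋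
n/2≡⌊n/2⌋ zero          = refl
n/2≡⌊n/2⌋ (suc zero)    = refl
n/2≡⌊n/2⌋ (suc (suc n)) = trans (m/n≡1+[m∸n]/n {suc (suc n)} {2} (s≤s (s≤s z≤n))) (cong suc (n/2≡⌊n/2⌋ n))

D-min : ∀ {n k} → 1 ≤ k → k ≤ n → D n ⌈ n /2⌉ ≤ D n k
D-min {n} {k} 1≤k k≤n with ≤-total k ⌈ n /2⌉
... | inj₁ k≤h = D-antitone 1≤k k≤h (2⌈n/2⌉≤1+n n)
... | inj₂ h≤k = D-monotone h≤k k≤n (n≤2⌈n/2⌉ n)

3p+3≤2^p : ∀ {p} → 4 ≤ p → 3 * p + 3 ≤ 2 ^ p
3p+3≤2^p 4≤p = go (≤⇒≤′ 4≤p)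
  where
    e : ∀ p → 3 * suc p + 3 ≡ (3 * p + 3) + 3
    e = solve-∀
    go : ∀ {p} → 4 ≤′ p → 3 * p + 3 ≤ 2 ^ p
    go ≤′-refl             = n≤1+n 15
    go (≤′-step {p} 4≤′p) = begin
      3 * suc p + 3          ≡⟨ e p ⟩
      (3 * p + 3) + 3        ≤⟨ +-mono-≤ (go 4≤′p) (≤-trans (m≤n+m 3 (3 * p)) (go 4≤′p)) ⟩
      2 ^ p + 2 ^ p          ≡⟨ 2x≡x+x (2 ^ p) ⟨
      2 ^ suc p              ∎
      where open ≤-Reasoning

1+j≤2^[j/3] : ∀ {j} → 12 ≤ j → suc j ≤ 2 ^ (j / 3)
1+j≤2^[j/3] {j} 12≤j = begin
  suc j                       ≡⟨ cong suc (m≡m%n+[m/n]*n j 3) ⟩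
  suc (j % 3 + j / 3 * 3)     ≤⟨ s≤s (+-monoˡ-≤ (j / 3 * 3) (≤-pred (m%n<n j 3))) ⟩
  3 + j / 3 * 3               ≡⟨ e (j / 3) ⟩
  3 * (j / 3) + 3             ≤⟨ 3p+3≤2^p (/-monoˡ-≤ 3 12≤j) ⟩
  2 ^ (j / 3)                 ∎
  where open ≤-Reasoning
        e : ∀ p → 3 + p * 3 ≡ 3 * p + 3
        e = solve-∀

-- For large j the linear factor j+1 is absorbed by the growth of C(n,·) between j and
-- the middle: (j+1)·C(n,j) ≤ C(n,l) whenever 4j+1 ≤ n and 2j ≤ l ≤ (n+1)/2.
1+j*C≤C : ∀ {n j l} → 12 ≤ j → 4 * j + 1 ≤ n → 2 * j ≤ l → 2 * l ≤ suc n →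
          suc j * (n C j) ≤ n C l
1+j*C≤C {n} {j} {l} 12≤j 4j+1≤n 2j≤l 2l≤1+n = begin
  suc j * (n C j)       ≤⟨ *-monoˡ-≤ (n C j) (1+j≤2^[j/3] 12≤j) ⟩
  2 ^ t * (n C j)       ≤⟨ C-doubling {n} {j} t 3[j+t]≤1+n ⟩
  n C (j + t)           ≤⟨ C-increasing j+t≤l 2l≤1+n ⟩
  n C l                 ∎
  where
    open ≤-Reasoning
    t = j / 3
    3t≤j : 3 * t ≤ j
    3t≤j = ≤-trans (≤-reflexive (*-comm 3 t)) (m/n*n≤m j 3)
    3[j+t]≤1+n : 3 * (j + t) ≤ suc n
    3[j+t]≤1+n = begin
      3 * (j + t)       ≡⟨ *-distribˡ-+ 3 j t ⟩
      3 * j + 3 * t     ≤⟨ +-monoʳ-≤ (3 * j) 3t≤j ⟩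
      3 * j + j         ≡⟨ e j ⟩
      4 * j             ≤⟨ ≤-trans (m≤m+n (4 * j) 1) (≤-trans 4j+1≤n (n≤1+n n)) ⟩
      suc n             ∎
      where e : ∀ j → 3 * j + j ≡ 4 * j
            e = solve-∀
    j+t≤l : j + t ≤ l
    j+t≤l = ≤-trans (+-monoʳ-≤ j (≤-trans (m≤n*m t 3) 3t≤j)) (≤-trans (≤-reflexive (sym (2x≡x+x j))) 2j≤l)

Private : ∀ {n} → List (Subset n) → Subset n → Fin n → Set
Private G g x = x ∈ g × (∀ {h} → h ∈ᴸ G → h ⊂ g → x ∉ h)

Private-sub : ∀ {n} {G G′ : List (Subset n)} {g x} → (∀ {h} → h ∈ᴸ G′ → h ∈ᴸ G) →
              Private G g x → Private G′ g x
Private-sub G′⊆G (x∈g , x∉smaller) = x∈g , λ h∈G′ → x∉smaller (G′⊆G h∈G′)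

PrivatePoints : ∀ {n} → List (Subset n) → Set
PrivatePoints S = ∀ {g} → g ∈ᴸ S → g ≢ ⊥ → ∃ (Private S g)

module WeightedLYM {n : ℕ} (a : ℕ) (1≤a : 1 ≤ a) where

  record Admissible (Y : Subset n) (G : List (Subset n)) : Set where
    field
      unique : Unique G
      subset : ∀ {g} → g ∈ᴸ G → g ⊆ Y
      large  : ∀ {g} → g ∈ᴸ G → a ≤ ∣ g ∣
      marked : ∀ {g} → g ∈ᴸ G → ∃ (Private G g)

  admissible-subfamily : ∀ {S G} → PrivatePoints S → Unique G → (∀ {g} → g ∈ᴸ G → g ∈ᴸ S) →
                         (∀ {g} → g ∈ᴸ G → a ≤ ∣ g ∣) → Admissible ⊤ G
  admissible-subfamily {G = G} privatePoints unique G⊆S large = record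
    { unique = unique
    ; subset = λ _ → ⊆⊤
    ; large  = large
    ; marked = λ m → let (x , x-private) = privatePoints (G⊆S m) (nonempty m) in x , Private-sub G⊆S x-private
    }
    where
      nonempty : ∀ {g} → g ∈ᴸ G → g ≢ ⊥
      nonempty {g} m refl = contradiction (≤-trans 1≤a (large m)) (λ 1≤∣⊥∣ → <⇒≱ 1≤∣⊥∣ (≤-reflexive (∣⊥∣≡0 n)))

  restrict : ∀ {Y Y′ G} {P : Subset n → Set} (P? : ∀ g → Dec (P g)) → Admissible Y G →
             (∀ {g} → g ∈ᴸ G → P g → g ⊆ Y′) → Admissible Y′ (filter P? G)
  restrict P? adm inY′ = record
    { unique = filter⁺ P? unique
    ; subset = λ m → let (g∈G , Pg) = ∈-filter⁻ P? m in inY′ g∈G Pg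
    ; large  = λ m → large (proj₁ (∈-filter⁻ P? m))
    ; marked = λ m → let (x , x-private) = marked (proj₁ (∈-filter⁻ P? m))
                     in x , Private-sub (λ h∈ → proj₁ (∈-filter⁻ P? h∈)) x-private
    }
    where open Admissible adm

  avoiding : Fin n → List (Subset n) → List (Subset n)
  avoiding y = filter (λ g → ¬? (y ∈? g))

  avoiding-admissible : ∀ {Y G} y → Admissible Y G → Admissible (Y - y) (avoiding y G)
  avoiding-admissible y adm = restrict (λ g → ¬? (y ∈? g)) adm (λ m y∉g → ⊆-minus (Admissible.subset adm m) y∉g)

  -- weight N g = a·(|g|-1)!·(N-|g|)!, i.e. N!·a/(|g|·C(N,|g|))
  weight : ℕ → Subset n → ℕ
  weight N g = a * D N ∣ g ∣

  weight-spread : ∀ {N Y g} → ∣ Y ∣ ≡ suc N → g ⊂ Y →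
                  weight (suc N) g ≡ ∑[ y < n ] when (y ∈? Y ─ g) (weight N g)
  weight-spread {N} {Y} {g} ∣Y∣≡1+N g⊂Y = begin
    a * D (suc N) ∣ g ∣                        ≡⟨ cong (a *_) (D-suc ∣g∣≤N) ⟩
    a * ((suc N ∸ ∣ g ∣) * D N ∣ g ∣)          ≡⟨ x*[y*z]≡y*[x*z] a (suc N ∸ ∣ g ∣) (D N ∣ g ∣) ⟩
    (suc N ∸ ∣ g ∣) * weight N g               ≡⟨ cong (_* weight N g) ∣Y─g∣ ⟨
    ∣ Y ─ g ∣ * weight N g                     ≡⟨ ∑-when-∈ (Y ─ g) (weight N g) ⟨
    ∑[ y < n ] when (y ∈? Y ─ g) (weight N g)  ∎
    where
      open ≡-Reasoning
      ∣g∣≤N = ≤-pred (≤-trans (p⊂q⇒∣p∣<∣q∣ g⊂Y) (≤-reflexive ∣Y∣≡1+N))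
      ∣Y─g∣ : ∣ Y ─ g ∣ ≡ suc N ∸ ∣ g ∣
      ∣Y─g∣ = trans (sym (m+n∸n≡m ∣ Y ─ g ∣ ∣ g ∣))
                    (cong (_∸ ∣ g ∣) (trans (∣─∣+∣∣≡∣∣ (proj₁ g⊂Y)) ∣Y∣≡1+N))

  regroup : ∀ {Y} N G y → sumᴸ G (λ g → when (y ∈? Y ─ g) (weight N g))
                        ≡ when (y ∈? Y) (sumᴸ (avoiding y G) (weight N))
  regroup {Y} N G y = begin
    sumᴸ G (λ g → when (y ∈? Y ─ g) (weight N g))
      ≡⟨ sumᴸ-cong G (λ {g} _ → when-─ y Y g (weight N g)) ⟩
    sumᴸ G (λ g → when (y ∈? Y) (when (¬? (y ∈? g)) (weight N g)))
      ≡⟨ sumᴸ-when (y ∈? Y) G _ ⟩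
    when (y ∈? Y) (sumᴸ G (λ g → when (¬? (y ∈? g)) (weight N g)))
      ≡⟨ cong (when (y ∈? Y)) (sumᴸ-filter (λ g → ¬? (y ∈? g)) G (weight N)) ⟨
    when (y ∈? Y) (sumᴸ (avoiding y G) (weight N))
      ∎
    where open ≡-Reasoning

  expand : ∀ {N Y G} → ∣ Y ∣ ≡ suc N → (∀ {g} → g ∈ᴸ G → g ⊂ Y) →
           sumᴸ G (weight (suc N)) ≡ ∑[ y < n ] when (y ∈? Y) (sumᴸ (avoiding y G) (weight N))
  expand {N} {Y} {G} ∣Y∣≡1+N proper = begin
    sumᴸ G (weight (suc N))
      ≡⟨ sumᴸ-cong G (λ m → weight-spread ∣Y∣≡1+N (proper m)) ⟩
    sumᴸ G (λ g → ∑[ y < n ] when (y ∈? Y ─ g) (weight N g))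
      ≡⟨ sumᴸ-∑-comm G (λ g y → when (y ∈? Y ─ g) (weight N g)) ⟩
    ∑[ y < n ] sumᴸ G (λ g → when (y ∈? Y ─ g) (weight N g))
      ≡⟨ sum-cong-≗ (regroup N G) ⟩
    ∑[ y < n ] when (y ∈? Y) (sumᴸ (avoiding y G) (weight N))
      ∎
    where open ≡-Reasoning

  Bound : ℕ → Set
  Bound N = ∀ {Y G} → ∣ Y ∣ ≡ N → Admissible Y G → sumᴸ G (weight N) ≤ N !

  AvoidingBound : ℕ → Set
  AvoidingBound N = ∀ {Y G x} → ∣ Y ∣ ≡ N → x ∈ Y → Admissible Y G →
                    (∀ {g} → g ∈ᴸ G → x ∉ g) → sumᴸ G (weight N) ≤ (N ∸ a) * (N ∸ 1) !

  ∣-∣≡ : ∀ {N} {Y : Subset n} {y} → ∣ Y ∣ ≡ suc N → y ∈ Y → ∣ Y - y ∣ ≡ N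
  ∣-∣≡ ∣Y∣≡1+N y∈Y = suc-injective (trans (∣-∣ y∈Y) ∣Y∣≡1+N)

  bound-zero : Bound 0
  bound-zero {G = []}    _     _   = z≤n
  bound-zero {G = g ∷ _} ∣Y∣≡0 adm =
    contradiction (≤-trans 1≤a (≤-trans (large (Any.here refl)) (p⊆q⇒∣p∣≤∣q∣ (subset (Any.here refl)))))
                  (λ 1≤∣Y∣ → <⇒≱ 1≤∣Y∣ (≤-reflexive ∣Y∣≡0))
    where open Admissible adm

  avoiding-zero : AvoidingBound 0
  avoiding-zero ∣Y∣≡0 x∈Y _ _ = contradiction (∈⇒1≤∣∣ x∈Y) (λ 1≤∣Y∣ → <⇒≱ 1≤∣Y∣ (≤-reflexive ∣Y∣≡0))

  -- If Y ∈ G, split Y off: the other members are proper subsets of Y and so avoid its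
  -- private point.  Otherwise every member is proper and the weights are expanded.
  bound-suc : ∀ {N} → Bound N → AvoidingBound (suc N) → Bound (suc N)
  bound-suc {N} bound avoidingBound {Y} {G} ∣Y∣≡1+N adm with ∈ᴸ-dec _≟ˢ_ Y G
  ... | yes Y∈G = begin
    sumᴸ G (weight (suc N))                        ≡⟨ sumᴸ-remove _≟ˢ_ unique Y∈G (weight (suc N)) ⟩
    weight (suc N) Y + sumᴸ G′ (weight (suc N))    ≤⟨ +-monoʳ-≤ (weight (suc N) Y) rest ⟩
    weight (suc N) Y + (suc N ∸ a) * N !           ≡⟨ cong (λ k → a * D (suc N) k + (suc N ∸ a) * N !) ∣Y∣≡1+N ⟩
    a * D (suc N) (suc N) + (suc N ∸ a) * N !      ≡⟨ D-top-identity a≤1+N ⟩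
    suc N !                                        ∎
    where
      open ≤-Reasoning
      open Admissible adm
      G′ = filter (λ g → ¬? (g ≟ˢ Y)) G
      a≤1+N = ≤-trans (large Y∈G) (≤-reflexive ∣Y∣≡1+N)
      x         = proj₁ (marked Y∈G)
      x∈Y       = proj₁ (proj₂ (marked Y∈G))
      x∉smaller = proj₂ (proj₂ (marked Y∈G))
      avoids : ∀ {g} → g ∈ᴸ G′ → x ∉ g
      avoids m = let (g∈G , g≢Y) = ∈-filter⁻ (λ g → ¬? (g ≟ˢ Y)) m
                 in x∉smaller g∈G (⊆∧≢⇒⊂ (subset g∈G) g≢Y)
      rest = avoidingBound ∣Y∣≡1+N x∈Y (restrict (λ g → ¬? (g ≟ˢ Y)) adm (λ m _ → subset m)) avoids
  ... | no Y∉G = begin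
    sumᴸ G (weight (suc N))                                      ≡⟨ expand ∣Y∣≡1+N proper ⟩
    ∑[ y < n ] when (y ∈? Y) (sumᴸ (avoiding y G) (weight N))    ≤⟨ ∑-mono-≤ pointwise ⟩
    ∑[ y < n ] when (y ∈? Y) (N !)                               ≡⟨ ∑-when-∈ Y (N !) ⟩
    ∣ Y ∣ * N !                                                  ≡⟨ cong (_* N !) ∣Y∣≡1+N ⟩
    suc N !                                                      ∎
    where
      open ≤-Reasoning
      open Admissible adm
      proper : ∀ {g} → g ∈ᴸ G → g ⊂ Y
      proper m = ⊆∧≢⇒⊂ (subset m) (λ g≡Y → Y∉G (subst (_∈ᴸ G) g≡Y m))
      pointwise : ∀ y → when (y ∈? Y) (sumᴸ (avoiding y G) (weight N)) ≤ when (y ∈? Y) (N !)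
      pointwise y with y ∈? Y
      ... | no  _   = z≤n
      ... | yes y∈Y = bound (∣-∣≡ ∣Y∣≡1+N y∈Y) (avoiding-admissible y adm)

  avoiding-pointwise : ∀ {N Y G x} → Bound N → AvoidingBound N → ∣ Y ∣ ≡ suc N → x ∈ Y →
                       Admissible Y G → (∀ {g} → g ∈ᴸ G → x ∉ g) → ∀ y →
                       when (y ∈? Y) (sumᴸ (avoiding y G) (weight N))
                         ≤ when (y ∈? Y - x) ((N ∸ a) * (N ∸ 1) !) + when (y ∈? ⁅ x ⁆) (N !)
  avoiding-pointwise {N} {Y} {G} {x} bound avoidingBound ∣Y∣≡1+N x∈Y adm x∉G y with y ∈? Y
  ... | no  _   = z≤n
  ... | yes y∈Y with y ∈? ⁅ x ⁆
  ...   | yes _     = ≤-trans (bound (∣-∣≡ ∣Y∣≡1+N y∈Y) (avoiding-admissible y adm)) (m≤n+m (N !) _)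
  ...   | no  y∉⁅x⁆ = begin
    sumᴸ (avoiding y G) (weight N)   ≤⟨ avoidingBound (∣-∣≡ ∣Y∣≡1+N y∈Y) x∈Y-y (avoiding-admissible y adm) avoids ⟩
    c                                ≡⟨ when-yes (y ∈? Y - x) (x∈p∧x∉q⇒x∈p─q y∈Y y∉⁅x⁆) c ⟨
    when (y ∈? Y - x) c              ≡⟨ +-identityʳ _ ⟨
    when (y ∈? Y - x) c + 0          ∎
    where
      open ≤-Reasoning
      c = (N ∸ a) * (N ∸ 1) !
      x∈Y-y = x∈p∧x≢y⇒x∈p-y x∈Y (λ x≡y → y∉⁅x⁆ (subst (_∈ ⁅ x ⁆) x≡y (x∈⁅x⁆ x)))
      avoids : ∀ {h} → h ∈ᴸ avoiding y G → x ∉ h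
      avoids m = x∉G (proj₁ (∈-filter⁻ (λ g → ¬? (y ∈? g)) m))

  avoiding-suc : ∀ {N} → Bound N → AvoidingBound N → AvoidingBound (suc N)
  avoiding-suc         bound avoidingBound {G = []}            _ _ _ _ = z≤n
  avoiding-suc {N} bound avoidingBound {Y} {G@(g ∷ _)} {x} ∣Y∣≡1+N x∈Y adm x∉G = begin
    sumᴸ G (weight (suc N))
      ≡⟨ expand ∣Y∣≡1+N proper ⟩
    ∑[ y < n ] when (y ∈? Y) (sumᴸ (avoiding y G) (weight N))
      ≤⟨ ∑-mono-≤ (avoiding-pointwise bound avoidingBound ∣Y∣≡1+N x∈Y adm x∉G) ⟩
    ∑[ y < n ] (when (y ∈? Y - x) c₂ + when (y ∈? ⁅ x ⁆) c₁)
      ≡⟨ ∑-distrib-+ (λ y → when (y ∈? Y - x) c₂) (λ y → when (y ∈? ⁅ x ⁆) c₁) ⟩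
    ∑[ y < n ] when (y ∈? Y - x) c₂ + ∑[ y < n ] when (y ∈? ⁅ x ⁆) c₁
      ≡⟨ cong₂ _+_ (∑-when-∈ (Y - x) c₂) (∑-when-∈ ⁅ x ⁆ c₁) ⟩
    ∣ Y - x ∣ * c₂ + ∣ ⁅ x ⁆ ∣ * c₁
      ≡⟨ cong₂ (λ s t → s * c₂ + t * c₁) (∣-∣≡ ∣Y∣≡1+N x∈Y) (∣⁅x⁆∣≡1 x) ⟩
    N * c₂ + 1 * c₁
      ≡⟨ cong (N * c₂ +_) (*-identityˡ c₁) ⟩
    N * c₂ + c₁
      ≡⟨ D-avoiding-identity a≤N ⟩
    (suc N ∸ a) * N !
      ∎
    where
      open ≤-Reasoning
      open Admissible adm
      c₁ = N !
      c₂ = (N ∸ a) * (N ∸ 1) !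
      proper : ∀ {h} → h ∈ᴸ G → h ⊂ Y
      proper m = subset m , x , x∈Y , x∉G m
      a≤N : a ≤ N
      a≤N = ≤-pred (≤-trans (s≤s (large (Any.here refl)))
                            (≤-trans (p⊂q⇒∣p∣<∣q∣ (proper (Any.here refl))) (≤-reflexive ∣Y∣≡1+N)))

  bounds : ∀ N → Bound N × AvoidingBound N
  bounds zero    = bound-zero , avoiding-zero
  bounds (suc N) = let (bound , avoidingBound) = bounds N
                       avoidingBound′ = avoiding-suc bound avoidingBound
                   in bound-suc bound avoidingBound′ , avoidingBound′

  weighted-LYM : ∀ N → Bound N
  weighted-LYM N = proj₁ (bounds N)

  band-bound : ∀ {G k₀} → 1 ≤ k₀ → k₀ ≤ n → Admissible ⊤ G →
               (∀ {g} → g ∈ᴸ G → D n k₀ ≤ D n ∣ g ∣) → length G * a ≤ k₀ * (n C k₀)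
  band-bound {G} {k₀} 1≤k₀ k₀≤n adm heavy = *-cancelʳ-≤ _ _ (D n k₀) {{(k₀ ∸ 1) !* (n ∸ k₀) !≢0}} (begin
    length G * a * D n k₀     ≡⟨ *-assoc (length G) a (D n k₀) ⟩
    length G * (a * D n k₀)   ≤⟨ length*≤sumᴸ G (λ m → *-monoʳ-≤ a (heavy m)) ⟩
    sumᴸ G (weight n)         ≤⟨ weighted-LYM n (∣⊤∣≡n n) adm ⟩
    n !                       ≡⟨ C-D-factorial 1≤k₀ k₀≤n ⟨
    k₀ * (n C k₀) * D n k₀    ∎)
    where open ≤-Reasoning

properParts : ∀ {n} → List (Subset n) → Subset n → List (Subset n)
properParts F g = filter (_⊂? g) F

⊂⇒≢ : ∀ {n} {p q : Subset n} → p ⊂ q → p ≢ q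
⊂⇒≢ p⊂q p≡q = ⊂-irref p≡q p⊂q

private-point : ∀ {n} {S F : List (Subset n)} {g} → (∀ {h} → h ∈ᴸ S → h ∈ᴸ F) →
                ⋃ (properParts F g) ≢ g → ∃ (Private S g)
private-point {S = S} {F} {g} S⊆F ⋃≢g =
  let (_ , x , x∈g , x∉⋃) = ⊆∧≢⇒⊂ (⋃-least parts⊆g) ⋃≢g
  in x , x∈g , λ h∈S h⊂g x∈h → x∉⋃ (⊆-⋃ (∈-filter⁺ (_⊂? g) (S⊆F h∈S) h⊂g) x∈h)
  where parts⊆g : ∀ {h} → h ∈ᴸ properParts F g → h ⊆ g
        parts⊆g m = proj₁ (proj₂ (∈-filter⁻ (_⊂? g) {xs = F} m))

module _ {n : ℕ} {F : Family n} (unionClosed : UnionClosed F) where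

  ⋃-closed : ∀ f T → (∀ {h} → h ∈ᴸ f ∷ T → h ∈ᴸ F) → ⋃ (f ∷ T) ∈ᴸ F
  ⋃-closed f []       inF = subst (_∈ᴸ F) (sym (∪-identityʳ f)) (inF (Any.here refl))
  ⋃-closed f (f′ ∷ T) inF = unionClosed (inF (Any.here refl)) (⋃-closed f′ T (inF ∘ Any.there))

  irreducible-not-union : ∀ {g} → Irreducible F g → g ≢ ⊥ → ∀ T → (∀ {h} → h ∈ᴸ T → h ∈ᴸ F × h ≢ g) → ⋃ T ≢ g
  irreducible-not-union irr g≢⊥ []           _     ⊥≡g  = g≢⊥ (sym ⊥≡g)
  irreducible-not-union irr g≢⊥ (f ∷ [])     parts f∪⊥≡g =
    proj₂ (parts (Any.here refl)) (trans (sym (∪-identityʳ f)) f∪⊥≡g)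
  irreducible-not-union irr g≢⊥ (f ∷ f′ ∷ T) parts ⋃≡g =
    [ proj₂ (parts (Any.here refl)) , irreducible-not-union irr g≢⊥ (f′ ∷ T) (parts ∘ Any.there) ]′
      (proj₂ irr (proj₁ (parts (Any.here refl))) (⋃-closed f′ T (proj₁ ∘ parts ∘ Any.there)) (sym ⋃≡g))

  irreducibles-private : ∀ {J} → All (Irreducible F) J → PrivatePoints J
  irreducibles-private irreducible {g} g∈J g≢⊥ =
    private-point (proj₁ ∘ All.lookup irreducible)
      (irreducible-not-union (All.lookup irreducible g∈J) g≢⊥ (properParts F g)
        (λ m → let (h∈F , h⊂g) = ∈-filter⁻ (_⊂? g) m in h∈F , ⊂⇒≢ h⊂g))

independent-private : ∀ {n} {S : Family n} → UnionIndependent S → PrivatePoints S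
independent-private {S = S} independent {g} g∈S g≢⊥ = private-point id ⋃≢g
  where
    ⋃≢g : ⋃ (properParts S g) ≢ g
    ⋃≢g ⋃≡g = independent g∈S
      ( properParts S g
      , (λ parts≡[] → g≢⊥ (trans (sym ⋃≡g) (cong ⋃ parts≡[])))
      , All.tabulate (λ m → let (h∈S , h⊂g) = ∈-filter⁻ (_⊂? g) m in h∈S , ⊂⇒≢ h⊂g)
      , sym ⋃≡g )

-- ⌈⌈n/2⌉/2⌉ = ⌈n/4⌉: members of size below it form the small band of the counting argument
quarter : ℕ → ℕ
quarter n = ⌈ ⌈ n /2⌉ /2⌉

-- The inequality that lets the small band fit under the binomial coefficient C(n,⌊n/2⌋+1).
Decay : ℕ → Set
Decay n = (quarter n ∸ 1) * (n C (quarter n ∸ 1)) + 1 ≤ n C suc (n / 2)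

-- For 1 ≤ n ≤ 48 the inequality is checked by evaluation.
decay-table : ∀ (i : Fin 48) → Decay (suc (toℕ i))
decay-table = toWitness {a? = all? (λ i → _ ≤? _)} tt

small-decay : ∀ {n} → 1 ≤ n → n ≤ 48 → Decay n
small-decay {suc n} _ n<48 = subst (λ k → Decay (suc k)) (toℕ-fromℕ< n<48) (decay-table (fromℕ< n<48))

1≤⌈n/2⌉ : ∀ {n} → 1 ≤ n → 1 ≤ ⌈ n /2⌉
1≤⌈n/2⌉ {suc n} _ = s≤s z≤n

-- The parameters of the counting argument and their linear relations:
-- h = ⌈n/2⌉ minimises D n, a = ⌈h/2⌉ is the band threshold, j = a - 1.
module Parameters {n : ℕ} (1≤n : 1 ≤ n) where

  h a j : ℕ
  h = ⌈ n /2⌉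
  a = quarter n
  j = a ∸ 1

  1≤h : 1 ≤ h
  1≤h = 1≤⌈n/2⌉ 1≤n

  1≤a : 1 ≤ a
  1≤a = 1≤⌈n/2⌉ 1≤h

  h≤n : h ≤ n
  h≤n = ⌈n/2⌉≤n n

  1+j≡a : suc j ≡ a
  1+j≡a = m+[n∸m]≡n 1≤a

  h≤2a : h ≤ 2 * a
  h≤2a = n≤2⌈n/2⌉ h

  2j+1≤h : 2 * j + 1 ≤ h
  2j+1≤h = ≤-pred (begin
    suc (2 * j + 1)  ≡⟨ e j ⟩
    2 * suc j        ≡⟨ cong (2 *_) 1+j≡a ⟩
    2 * a            ≤⟨ 2⌈n/2⌉≤1+n h ⟩
    suc h            ∎)
    where open ≤-Reasoning
          e : ∀ j → suc (2 * j + 1) ≡ 2 * suc j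
          e = solve-∀

  2j≤h∸1 : 2 * j ≤ h ∸ 1
  2j≤h∸1 = m+n≤o⇒m≤o∸n (2 * j) 2j+1≤h

  2[h∸1]≤1+n : 2 * (h ∸ 1) ≤ suc n
  2[h∸1]≤1+n = ≤-trans (*-monoʳ-≤ 2 (m∸n≤m h 1)) (2⌈n/2⌉≤1+n n)

  2j≤1+n : 2 * j ≤ suc n
  2j≤1+n = ≤-trans (*-monoʳ-≤ 2 (≤-trans (m≤n*m j 2) 2j≤h∸1)) 2[h∸1]≤1+n

  4j+1≤n : 4 * j + 1 ≤ n
  4j+1≤n = +-cancelˡ-≤ 2 _ _ (begin
    2 + (4 * j + 1)   ≡⟨ e j ⟩
    2 * (2 * j + 1) + 1 ≤⟨ +-monoˡ-≤ 1 (*-monoʳ-≤ 2 2j+1≤h) ⟩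
    2 * h + 1         ≤⟨ +-monoˡ-≤ 1 (2⌈n/2⌉≤1+n n) ⟩
    suc n + 1         ≡⟨ +-comm (suc n) 1 ⟩
    2 + n             ∎)
    where open ≤-Reasoning
          e : ∀ j → 2 + (4 * j + 1) ≡ 2 * (2 * j + 1) + 1
          e = solve-∀

  j≤n : j ≤ n
  j≤n = ≤-trans (m≤n*m j 4) (≤-trans (m≤m+n (4 * j) 1) 4j+1≤n)

  n≤4[1+j] : n ≤ 4 * suc j
  n≤4[1+j] = begin
    n               ≤⟨ n≤2⌈n/2⌉ n ⟩
    2 * h           ≤⟨ *-monoʳ-≤ 2 h≤2a ⟩
    2 * (2 * a)     ≡⟨ cong (λ x → 2 * (2 * x)) 1+j≡a ⟨
    2 * (2 * suc j) ≡⟨ *-assoc 2 2 (suc j) ⟨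
    4 * suc j       ∎
    where open ≤-Reasoning

  n∸h≡n/2 : n ∸ h ≡ n / 2
  n∸h≡n/2 = trans (cong (_∸ h) (sym (⌊n/2⌋+⌈n/2⌉≡n n))) (trans (m+n∸n≡m ⌊ n /2⌋ h) (sym (n/2≡⌊n/2⌋ n)))

  C[n,h]≡C[n,n/2] : n C h ≡ n C (n / 2)
  C[n,h]≡C[n,n/2] = trans (nCk≡nC[n∸k] h≤n) (cong (n C_) n∸h≡n/2)

  n/2<n : n / 2 < n
  n/2<n = subst (_< n) (sym (n/2≡⌊n/2⌋ n)) (begin
    suc ⌊ n /2⌋      ≡⟨ +-comm 1 ⌊ n /2⌋ ⟩
    ⌊ n /2⌋ + 1      ≤⟨ +-monoʳ-≤ ⌊ n /2⌋ 1≤h ⟩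
    ⌊ n /2⌋ + h      ≡⟨ ⌊n/2⌋+⌈n/2⌉≡n n ⟩
    n                ∎)
    where open ≤-Reasoning

  n∸n/2≡h : n ∸ n / 2 ≡ h
  n∸n/2≡h = trans (cong (n ∸_) (n/2≡⌊n/2⌋ n))
                  (trans (cong (_∸ ⌊ n /2⌋) (sym (⌊n/2⌋+⌈n/2⌉≡n n))) (m+n∸m≡n ⌊ n /2⌋ h))

  C[n,h∸1]≡C[n,1+n/2] : n C (h ∸ 1) ≡ n C suc (n / 2)
  C[n,h∸1]≡C[n,1+n/2] = begin
    n C (h ∸ 1)              ≡⟨ cong (λ k → n C (k ∸ 1)) n∸n/2≡h ⟨
    n C (n ∸ n / 2 ∸ 1)      ≡⟨ cong (n C_) (trans (∸-+-assoc n (n / 2) 1) (cong (n ∸_) (+-comm (n / 2) 1))) ⟩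
    n C (n ∸ suc (n / 2))    ≡⟨ nCk≡nC[n∸k] n/2<n ⟨
    n C suc (n / 2)          ∎
    where open ≡-Reasoning

  -- the decay inequality: by binomial growth for j ≥ 12, and from the table otherwise,
  -- as then n ≤ 4(j+1) ≤ 48
  decay : Decay n
  decay with 12 ≤? j
  ... | yes 12≤j = begin
    j * (n C j) + 1          ≤⟨ +-monoʳ-≤ (j * (n C j)) (C-positive j≤n) ⟩
    j * (n C j) + n C j      ≡⟨ +-comm (j * (n C j)) (n C j) ⟩
    suc j * (n C j)          ≤⟨ 1+j*C≤C 12≤j 4j+1≤n 2j≤h∸1 2[h∸1]≤1+n ⟩
    n C (h ∸ 1)              ≡⟨ C[n,h∸1]≡C[n,1+n/2] ⟩
    n C suc (n / 2)          ∎
    where open ≤-Reasoning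
  ... | no  12≰j = small-decay 1≤n (≤-trans n≤4[1+j] (*-monoʳ-≤ 4 (≰⇒> 12≰j)))

module Bands {n : ℕ} (1≤n : 1 ≤ n) {S : List (Subset n)} (unique : Unique S)
             (privatePoints : PrivatePoints S) where

  open Parameters 1≤n

  small? : (g : Subset n) → Dec (∣ g ∣ < a)
  small? g = ∣ g ∣ <? a

  empties nonempty small big : List (Subset n)
  empties  = filter (_≟ˢ ⊥) S
  nonempty = filter (λ g → ¬? (g ≟ˢ ⊥)) S
  small    = filter small? nonempty
  big      = filter (λ g → ¬? (small? g)) nonempty

  length-bands : length S ≡ length empties + (length small + length big)
  length-bands = trans (length-filter-split (_≟ˢ ⊥) S)
                       (cong (length empties +_) (length-filter-split small? nonempty))

  at-most-one-empty : length empties ≤ 1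
  at-most-one-empty = unique-constant empties (filter⁺ (_≟ˢ ⊥) unique) (λ m → proj₂ (∈-filter⁻ (_≟ˢ ⊥) {xs = S} m))

  nonempty-∈ : ∀ {g} → g ∈ᴸ nonempty → g ∈ᴸ S × g ≢ ⊥
  nonempty-∈ = ∈-filter⁻ (λ g → ¬? (g ≟ˢ ⊥))

  nonempty-unique : Unique nonempty
  nonempty-unique = filter⁺ (λ g → ¬? (g ≟ˢ ⊥)) unique

  big-∈ : ∀ {g} → g ∈ᴸ big → g ∈ᴸ nonempty × a ≤ ∣ g ∣
  big-∈ m = let (g∈ , ¬small) = ∈-filter⁻ (λ g → ¬? (small? g)) m in g∈ , ≮⇒≥ ¬small

  -- members of size ≥ a have weight ≥ a·D n h, so there are at most h·C(n,h)/a ≤ 2·C(n,h)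
  big-bound : length big ≤ 2 * (n C h)
  big-bound = *-cancelʳ-≤ (length big) (2 * (n C h)) a {{>-nonZero 1≤a}} (begin
    length big * a     ≤⟨ band-bound 1≤h h≤n admissible heavy ⟩
    h * (n C h)        ≤⟨ *-monoˡ-≤ (n C h) h≤2a ⟩
    2 * a * (n C h)    ≡⟨ e 2 a (n C h) ⟩
    2 * (n C h) * a    ∎)
    where
      open ≤-Reasoning
      open WeightedLYM a 1≤a
      e : ∀ x y z → x * y * z ≡ x * z * y
      e = solve-∀
      admissible = admissible-subfamily privatePoints (filter⁺ (λ g → ¬? (small? g)) nonempty-unique)
                     (proj₁ ∘ nonempty-∈ ∘ proj₁ ∘ big-∈) (proj₂ ∘ big-∈)
      heavy : ∀ {g} → g ∈ᴸ big → D n h ≤ D n ∣ g ∣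
      heavy {g} m = D-min (≤-trans 1≤a (proj₂ (big-∈ m))) (∣p∣≤n g)

  small-∈ : ∀ {g} → g ∈ᴸ small → g ∈ᴸ nonempty × 1 ≤ ∣ g ∣ × ∣ g ∣ ≤ j
  small-∈ {g} m = let (g∈ , ∣g∣<a) = ∈-filter⁻ small? {xs = nonempty} m
                  in g∈ , ≢⊥⇒1≤∣∣ (proj₂ (nonempty-∈ g∈)) , ≤-pred (subst (∣ g ∣ <_) (sym 1+j≡a) ∣g∣<a)

  -- members of size in [1, j] have weight ≥ D n j (with a = 1), so there are at most j·C(n,j)
  small-bound : length small ≤ j * (n C j)
  small-bound with 1 ≤? j
  ... | no  1≰j = ≤-trans (≤-reflexive (length-absurd small absurd)) z≤n
    where absurd : ∀ {g} → g ∈ᴸ small → ⊥′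
          absurd m = let (_ , 1≤ , ≤j) = small-∈ m in 1≰j (≤-trans 1≤ ≤j)
  ... | yes 1≤j = ≤-trans (≤-reflexive (sym (*-identityʳ (length small)))) (band-bound 1≤j j≤n admissible heavy)
    where
      open WeightedLYM 1 ≤-refl
      admissible = admissible-subfamily privatePoints (filter⁺ small? nonempty-unique)
                     (proj₁ ∘ nonempty-∈ ∘ proj₁ ∘ small-∈) (proj₁ ∘ proj₂ ∘ small-∈)
      heavy : ∀ {g} → g ∈ᴸ small → D n j ≤ D n ∣ g ∣
      heavy m = let (_ , 1≤ , ≤j) = small-∈ m in D-antitone 1≤ ≤j 2j≤1+n

private-points-bound : ∀ {n} → 1 ≤ n → (S : List (Subset n)) → Unique S → PrivatePoints S → length S ≤ bound n
private-points-bound {n} 1≤n S unique privatePoints = begin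
  length S                                      ≡⟨ length-bands ⟩
  length empties + (length small + length big)  ≤⟨ +-mono-≤ at-most-one-empty (+-mono-≤ small-bound big-bound) ⟩
  1 + (j * (n C j) + 2 * (n C h))               ≡⟨ e 1 (j * (n C j)) (2 * (n C h)) ⟩
  2 * (n C h) + (j * (n C j) + 1)               ≤⟨ +-mono-≤ (≤-reflexive (cong (2 *_) C[n,h]≡C[n,n/2])) decay ⟩
  bound n                                       ∎
  where
    open ≤-Reasoning
    open Parameters 1≤n
    open Bands 1≤n unique privatePoints
    e : ∀ x y z → x + (y + z) ≡ z + (y + x)
    e = solve-∀

-- Irreducible elements of a union-closed family, and ∪-independent families, have private
-- points.
corollary6p6 : (n : ℕ) → 1 ≤ n →
    ((F : Family n) → UnionClosed F → Covers F →
      (J : List (Subset n)) → Unique J → All (Irreducible F) J →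
      length J ≤ bound n)
    × ((S : List (Subset n)) → Unique S → bound n < length S →
      ¬ UnionIndependent S)
corollary6p6 n 1≤n =
  (λ F unionClosed _ J unique irreducible →
     private-points-bound 1≤n J unique (irreducibles-private unionClosed irreducible)) ,
  (λ S unique bound<∣S∣ independent →
     <⇒≱ bound<∣S∣ (private-points-bound 1≤n S unique (independent-private independent)))
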